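{- Let $\psi_i := \hat{Q}_i.\,\phi_i$ be a closed PCNF and let $\gamma_i$ be a set of cubes each of which has a cube derivation from $\psi_i$ (as produced by cube learning in QCDCL). Let $\phi^{\mathit{del}}_{i+1} \subseteq \phi_i$ be a set of clauses, let $\phi_{i+1} := \phi_i \setminus \phi^{\mathit{del}}_{i+1}$, let $V^{\mathit{del}}_{i+1}$ be the set of variables of $\psi_i$ that no longer occur in $\phi_{i+1}$, and let $\hat{Q}_{i+1}$ be obtained from $\hat{Q}_i$ by removing the variables in $V^{\mathit{del}}_{i+1}$ (and any resulting empty blocks), so that $\psi_{i+1} := \hat{Q}_{i+1}.\,\phi_{i+1}$ is closed. For a cube $C \in \gamma_i$, let $C' := C \setminus \{l \mid v(l) \in V^{\mathit{del}}_{i+1}\}$. Then $\hat{Q}_{i+1}.\,\phi_{i+1}$ and $\hat{Q}_{i+1}.\,(\phi_{i+1} \vee C')$ are satisfiability-equivalent, i.e. one is satisfiable iff the other is.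
   Context: A literal is a variable $x$ or its negation $\neg x$; $v(l)$ denotes the variable of literal $l$. A clause (cube) is a disjunction (conjunction) of literals, viewed as a set of literals; a cube is contradictory if it contains both $x$ and $\neg x$. A PCNF $\hat{Q}.\,\phi$ consists of a CNF $\phi$ (a set of clauses) and a quantifier prefix $\hat{Q} = Q_1B_1\ldots Q_nB_n$ with $Q_i\in\{\forall,\exists\}$, nonempty pairwise disjoint variable blocks $B_i$, and $Q_i\neq Q_{i+1}$; it is closed if exactly the variables occurring in $\phi$ are quantified. Variables (and their literals) are ordered by $l<l'$ iff $v(l)\in B_i$, $v(l')\in B_j$ with $i<j$; a literal is universal/existential according to the quantifier of its block. An assignment is a set of literals; $\psi[A]$ replaces assigned variables by truth constants, simplifies, and removes superfluous quantified variables; the semantics is the usual one for closed QBFs ($\top$ satisfiable, $\bot$ unsatisfiable, $\forall x$ requires both $\psi[x],\psi[\neg x]$ satisfiable, $\exists x$ requires one of them). For a formula $\hat{Q}.(\phi\vee C)$ with a cube $C$ the matrix is the propositional formula $\phi \vee C$ under the same prefix. Cube derivations from a PCNF $\psi$ are built by the following rules: (i) model generation: if $A$ is an assignment with $\psi[A]=\top$ (a model of $\psi$), then the initial cube $\bigwedge_{l\in A} l$ may be derived; (ii) existential reduction: from a cube $C$ derive $\mathrm{ER}(C) := C \setminus \{l \mid l \text{ existential and } l' < l \text{ for all universal } l' \in C\}$; (iii) cube resolution: from non-contradictory derived cubes $C_1,C_2$ and a universal variable $p$ with $p\in C_1$, $\neg p\in C_2$, derive $(\mathrm{ER}(C_1)\setminus\{p\})\cup(\mathrm{ER}(C_2)\setminus\{\neg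 p\})$ provided this set is non-contradictory. -}

module Defs where

open import Data.Nat using (ℕ; zero; suc; _<ᵇ_; _≡ᵇ_)
open import Data.Bool using (Bool; true; false; _∧_; _∨_; not; if_then_else_)
open import Data.List using (List; []; _∷_; _++_; concatMap)
open import Data.Bool.ListAction using (any; all)
open import Data.List.Membership.Propositional using (_∈_)
open import Data.List.Relation.Unary.All using (All)
open import Data.List.Relation.Unary.Any using (Any)
open import Data.List.Relation.Unary.Unique.Propositional using (Unique)
open import Data.Maybe using (Maybe; just; nothing)
open import Data.Product using (_×_; _,_; proj₁; proj₂; Σ; ∃)
open import Relation.Binary.PropositionalEquality using (_≡_; _≢_)
open import Relation.Nullary using (¬_)
open import Function.Bundles using (_⇔_)

data Quant : Set where
  ∀q ∃q : Quant

quantEq : Quant → Quant → Bool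
quantEq ∀q ∀q = true
quantEq ∃q ∃q = true
quantEq _  _  = false

record Lit : Set where
  constructor lit
  field
    var : ℕ
    pos : Bool
open Lit public

negLit : Lit → Lit
negLit (lit x b) = lit x (not b)

boolEq : Bool → Bool → Bool
boolEq true true = true
boolEq false false = true
boolEq _ _ = false

litEq : Lit → Lit → Bool
litEq (lit x b) (lit y c) = (x ≡ᵇ y) ∧ boolEq b c

Clause : Set
Clause = List Lit

Cube : Set
Cube = List Lit

CNF : Set
CNF = List Clause

Block : Set
Block = Quant × List ℕ

Prefix : Set
Prefix = List Block

record PCNF : Set where
  constructor _∙_
  field
    prefix : Prefix
    matrix : CNF
open PCNF public

filterB : {A : Set} → (A → Bool) → List A → List A
filterB p [] = []
filterB p (x ∷ xs) = if p x then x ∷ filterB p xs else filterB p xs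

memNat : ℕ → List ℕ → Bool
memNat x = any (λ y → x ≡ᵇ y)

clauseEq : Clause → Clause → Bool
clauseEq [] [] = true
clauseEq (l ∷ C) (l' ∷ C') = litEq l l' ∧ clauseEq C C'
clauseEq _ _ = false

memClause : Clause → CNF → Bool
memClause C = any (clauseEq C)

prefixVars : Prefix → List ℕ
prefixVars = concatMap proj₂

Occurs : ℕ → CNF → Set
Occurs x φ = Any (λ C → Any (λ l → var l ≡ x) C) φ

occursB : CNF → ℕ → Bool
occursB φ x = any (λ C → any (λ l → var l ≡ᵇ x) C) φ

data Alternating : Prefix → Set where
  alt[]  : Alternating []
  alt[_] : (b : Block) → Alternating (b ∷ [])
  alt∷   : ∀ {q q' xs ys rest} → q ≢ q' →
           Alternating ((q' , ys) ∷ rest) →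
           Alternating ((q , xs) ∷ (q' , ys) ∷ rest)

record IsPCNF (ψ : PCNF) : Set where
  field
    nonemptyBlocks : All (λ b → proj₂ b ≢ []) (prefix ψ)
    disjointBlocks : Unique (prefixVars (prefix ψ))
    alternating    : Alternating (prefix ψ)

IsClosed : PCNF → Set
IsClosed ψ = ∀ x → (x ∈ prefixVars (prefix ψ)) ⇔ Occurs x (matrix ψ)

record IsClosedPCNF (ψ : PCNF) : Set where
  field
    isPCNF : IsPCNF ψ
    closed : IsClosed ψ

Valuation : Set
Valuation = ℕ → Bool

litVal : Valuation → Lit → Bool
litVal ρ (lit x true)  = ρ x
litVal ρ (lit x false) = not (ρ x)

clauseVal : Valuation → Clause → Bool
clauseVal ρ C = any (litVal ρ) C

cnfVal : CNF → Valuation → Bool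
cnfVal φ ρ = all (clauseVal ρ) φ

cubeVal : Cube → Valuation → Bool
cubeVal C ρ = all (litVal ρ) C

update : Valuation → ℕ → Bool → Valuation
update ρ x b y = if y ≡ᵇ x then b else ρ y

flatten : Prefix → List (Quant × ℕ)
flatten [] = []
flatten ((q , []) ∷ Q) = flatten Q
flatten ((q , x ∷ xs) ∷ Q) = (q , x) ∷ flatten ((q , xs) ∷ Q)

quantOp : Quant → Bool → Bool → Bool
quantOp ∀q = _∧_
quantOp ∃q = _∨_

evalVars : List (Quant × ℕ) → (Valuation → Bool) → Valuation → Bool
evalVars [] f ρ = f ρ
evalVars ((q , x) ∷ qs) f ρ =
  quantOp q (evalVars qs f (update ρ x true)) (evalVars qs f (update ρ x false))

Satisfiable : Prefix → (Valuation → Bool) → Set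
Satisfiable Q M = evalVars (flatten Q) M (λ _ → false) ≡ true

blockOfFrom : ℕ → Prefix → ℕ → Maybe (ℕ × Quant)
blockOfFrom i [] x = nothing
blockOfFrom i ((q , xs) ∷ Q) x =
  if memNat x xs then just (i , q) else blockOfFrom (suc i) Q x

blockOf : Prefix → ℕ → Maybe (ℕ × Quant)
blockOf = blockOfFrom 0

isExistB : Prefix → Lit → Bool
isExistB Q l with blockOf Q (var l)
... | just (_ , ∃q) = true
... | _ = false

isUnivB : Prefix → Lit → Bool
isUnivB Q l with blockOf Q (var l)
... | just (_ , ∀q) = true
... | _ = false

ltB : Prefix → Lit → Lit → Bool
ltB Q l l' with blockOf Q (var l) | blockOf Q (var l')
... | just (i , _) | just (j , _) = i <ᵇ j
... | _ | _ = false

UniversalVar : Prefix → ℕ → Set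
UniversalVar Q p = ∃ λ i → blockOf Q p ≡ just (i , ∀q)

Contradictory : Cube → Set
Contradictory C = Any (λ l → negLit l ∈ C) C

ER : Prefix → Cube → Cube
ER Q C = filterB (λ l → not (isExistB Q l ∧ all (λ l' → not (isUnivB Q l') ∨ ltB Q l' l) C)) C

removeLit : Lit → Cube → Cube
removeLit l C = filterB (λ l' → not (litEq l' l)) C

resolvent : Prefix → Cube → Cube → ℕ → Cube
resolvent Q C₁ C₂ p = removeLit (lit p true) (ER Q C₁) ++ removeLit (lit p false) (ER Q C₂)

IsModel : PCNF → List Lit → Set
IsModel ψ A =
  ¬ Contradictory A ×
  All (λ l → var l ∈ prefixVars (prefix ψ)) A ×
  All (λ C → Any (_∈ A) C) (matrix ψ)

data CubeDerivable (ψ : PCNF) : Cube → Set where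
  modelGen : (A : List Lit) → IsModel ψ A → CubeDerivable ψ A
  existRed : {C : Cube} → CubeDerivable ψ C → CubeDerivable ψ (ER (prefix ψ) C)
  cubeRes  : {C₁ C₂ : Cube} (p : ℕ) →
             CubeDerivable ψ C₁ → CubeDerivable ψ C₂ →
             ¬ Contradictory C₁ → ¬ Contradictory C₂ →
             UniversalVar (prefix ψ) p →
             lit p true ∈ C₁ → lit p false ∈ C₂ →
             ¬ Contradictory (resolvent (prefix ψ) C₁ C₂ p) →
             CubeDerivable ψ (resolvent (prefix ψ) C₁ C₂ p)

deleteClauses : CNF → CNF → CNF
deleteClauses φ φdel = filterB (λ C → not (memClause C φdel)) φ

inVdel : Prefix → CNF → ℕ → Bool
inVdel Q φ' x = memNat x (prefixVars Q) ∧ not (occursB φ' x)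

consBlock : Quant → List ℕ → Prefix → Prefix
consBlock q [] rest = rest
consBlock q ys [] = (q , ys) ∷ []
consBlock q ys ((q' , zs) ∷ rest) =
  if quantEq q q' then (q , ys ++ zs) ∷ rest else (q , ys) ∷ (q' , zs) ∷ rest

removeVars : (ℕ → Bool) → Prefix → Prefix
removeVars del [] = []
removeVars del ((q , xs) ∷ Q) =
  consBlock q (filterB (λ x → not (del x)) xs) (removeVars del Q)

reduceCube : (ℕ → Bool) → Cube → Cube
reduceCube del C = filterB (λ l → not (del (var l))) C

-- Write D' for the cube D without its literals over deleted variables. By induction
-- on cube derivations, for every matrix M implied by φ', satisfiability of Q.(M ∨ D')
-- implies that of Q.M. A model A of φ hits every clause of φ' in a literal over a
-- variable of φ', so A' still implies φ'. For existential reduction, split Q after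
-- the last universal block of D: the literals removed by ER are existential and lie
-- in that tail, so if ER(D)' holds on entering the tail the existential player can
-- make D' true there, and otherwise ER(D)' stays false throughout the tail.
-- Resolution is a case split on the value of the pivot. Finally the deleted
-- variables occur neither in φ' nor in C', so quantifying them (Q) or not (Q')
-- changes nothing.

module Submission where

open import Defs
open import Data.Bool using (Bool; true; false; _∧_; _∨_; not; T; if_then_else_)
import Data.Bool as Bool
open import Data.Bool.Properties using (T-≡; T-∧; T-∨; ∨-assoc; ¬-not)
open import Data.Bool.ListAction using (any; all)
open import Data.Empty using (⊥; ⊥-elim)
open import Data.Nat using (ℕ; zero; suc; _+_; _≤_; _<_; _⊔_; z≤n; s≤s; _≡ᵇ_; _≟_)
open import Data.Nat.Properties
  using ( ≡ᵇ⇒≡; ≡⇒≡ᵇ; <ᵇ⇒<; <⇒<ᵇ; ≤-trans; ≤-reflexive; +-identityʳ; n≤1+n; m≤m+n; +-suc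
        ; 1+n≰n; <⇒≱; m≤m⊔n; m≤n⊔m; ⊔-lub)
open import Data.List using (List; []; _∷_; _++_; map; take; drop; foldr)
open import Data.List.Properties using (take++drop≡id; map-++; ++-assoc)
open import Data.List.Membership.Propositional using (_∈_; _∉_; lose; find)
open import Data.List.Membership.Propositional.Properties
  using (∈-map⁺; ∈-map⁻; ∈-++⁺ˡ; ∈-++⁺ʳ; ∈-++⁻)
open import Data.List.Relation.Unary.All using (All)
import Data.List.Relation.Unary.All as All
open import Data.List.Relation.Unary.All.Properties using (all⁺; all⁻)
open import Data.List.Relation.Unary.Any using (here; there)
import Data.List.Relation.Unary.Any as Any
open import Data.List.Relation.Unary.Any.Properties using (any⁺; any⁻)
open import Data.List.Relation.Unary.AllPairs using (_∷_)
open import Data.List.Relation.Unary.Unique.Propositional using (Unique)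
open import Data.Maybe using (just; nothing)
open import Data.Product using (_×_; _,_; proj₁; proj₂; ∃-syntax)
import Data.Product as Prod
open import Data.Sum using (_⊎_; inj₁; inj₂)
import Data.Sum as Sum
open import Data.Unit using (tt)
open import Function using (_∘_; id)
open import Function.Bundles using (_⇔_; mk⇔; Equivalence)
open import Relation.Binary.PropositionalEquality
open import Relation.Nullary using (¬_; yes; no)

open Equivalence using (to; from)

private variable
  A B : Set
  l : Lit
  x : ℕ
  q : Quant
  C D E : Cube

∈-filterB⁻ : ∀ (p : A → Bool) {xs a} → a ∈ filterB p xs → a ∈ xs × T (p a)
∈-filterB⁻ p {y ∷ ys} m with p y in py
∈-filterB⁻ p {y ∷ ys} (here refl) | true = here refl , from T-≡ py
∈-filterB⁻ p {y ∷ ys} (there m)   | true = Prod.map₁ there (∈-filterB⁻ p m)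
∈-filterB⁻ p {y ∷ ys} m           | false = Prod.map₁ there (∈-filterB⁻ p m)

∈-filterB⁺ : ∀ (p : A → Bool) {xs a} → a ∈ xs → T (p a) → a ∈ filterB p xs
∈-filterB⁺ p {y ∷ ys} (here refl) pa with p y
... | true = here refl
∈-filterB⁺ p {y ∷ ys} (there m) pa with p y
... | true  = there (∈-filterB⁺ p m pa)
... | false = ∈-filterB⁺ p m pa

filterB-++ : ∀ (p : A → Bool) xs ys → filterB p (xs ++ ys) ≡ filterB p xs ++ filterB p ys
filterB-++ p [] ys = refl
filterB-++ p (x ∷ xs) ys with p x
... | true  = cong (x ∷_) (filterB-++ p xs ys)
... | false = filterB-++ p xs ys

filterB-map : ∀ (p : B → Bool) (f : A → B) xs → filterB p (map f xs) ≡ map f (filterB (p ∘ f) xs)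
filterB-map p f []       = refl
filterB-map p f (x ∷ xs) with p (f x)
... | true  = cong (f x ∷_) (filterB-map p f xs)
... | false = filterB-map p f xs

memNat⇒∈ : ∀ {xs} → T (memNat x xs) → x ∈ xs
memNat⇒∈ {x} h = Any.map (λ {y} → ≡ᵇ⇒≡ x y) (any⁻ _ _ h)

∈⇒memNat : ∀ {xs} → x ∈ xs → memNat x xs ≡ true
∈⇒memNat {x} m = to T-≡ (any⁺ _ (Any.map (λ {y} → ≡⇒≡ᵇ x y) m))

∉⇒memNat : ∀ {xs} → x ∉ xs → memNat x xs ≡ false
∉⇒memNat {x} {xs} x∉xs with memNat x xs in e
... | true  = ⊥-elim (x∉xs (memNat⇒∈ (from T-≡ e)))
... | false = refl

litEq⇒≡ : ∀ l l' → T (litEq l l') → l ≡ l'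
litEq⇒≡ (lit x b) (lit y c) h with to T-∧ h
... | x≡y , b≡c = cong₂ lit (≡ᵇ⇒≡ x y x≡y) (boolEq⇒≡ b c b≡c)
  where
  boolEq⇒≡ : ∀ b c → T (boolEq b c) → b ≡ c
  boolEq⇒≡ true  true  _ = refl
  boolEq⇒≡ false false _ = refl

removeLit-cover : ∀ l₀ {C} → l ∈ C → l ≡ l₀ ⊎ l ∈ removeLit l₀ C
removeLit-cover {l} l₀ m with litEq l l₀ in e
... | true  = inj₁ (litEq⇒≡ l l₀ (from T-≡ e))
... | false = inj₂ (∈-filterB⁺ _ m (subst (T ∘ not) (sym e) tt))

Unique-++⁻ʳ : ∀ (xs : List ℕ) {ys} → Unique (xs ++ ys) → Unique ys
Unique-++⁻ʳ []       u       = u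
Unique-++⁻ʳ (_ ∷ xs) (_ ∷ u) = Unique-++⁻ʳ xs u

Unique-++-disjoint : ∀ (xs : List ℕ) {ys} → Unique (xs ++ ys) → x ∈ ys → x ∉ xs
Unique-++-disjoint (_ ∷ xs) (z≢ ∷ _) x∈ys (here refl) = All.lookup z≢ (∈-++⁺ʳ xs x∈ys) refl
Unique-++-disjoint (_ ∷ xs) (_ ∷ u)  x∈ys (there m)   = Unique-++-disjoint xs u x∈ys m

Matrix : Set
Matrix = Valuation → Bool

_⇒ᴹ_ : Matrix → Matrix → Set
M ⇒ᴹ N = ∀ ρ → T (M ρ) → T (N ρ)

_∨ᶜ_ : Matrix → Cube → Matrix
(M ∨ᶜ C) ρ = M ρ ∨ cubeVal C ρ

boundVars : List (Quant × ℕ) → List ℕ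
boundVars = map proj₂

update-≡ : ∀ ρ x b → update ρ x b x ≡ b
update-≡ ρ x b with x ≡ᵇ x | ≡⇒≡ᵇ x x refl
... | true | _ = refl

update-≢ : ∀ ρ x b {y} → y ≢ x → update ρ x b y ≡ ρ y
update-≢ ρ x b {y} y≢x with y ≡ᵇ x in e
... | true  = ⊥-elim (y≢x (≡ᵇ⇒≡ y x (from T-≡ e)))
... | false = refl

litVal-cong : ∀ {ρ σ} l → ρ (var l) ≡ σ (var l) → litVal ρ l ≡ litVal σ l
litVal-cong (lit x true)  e = e
litVal-cong (lit x false) e = cong not e

litVal-update-pos : ∀ ρ l → T (litVal (update ρ (var l) (pos l)) l)
litVal-update-pos ρ (lit x true)  rewrite update-≡ ρ x true  = tt
litVal-update-pos ρ (lit x false) rewrite update-≡ ρ x false = tt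

cubeVal-cong : ∀ {ρ σ} C → (∀ {l} → l ∈ C → ρ (var l) ≡ σ (var l)) → cubeVal C ρ ≡ cubeVal C σ
cubeVal-cong []      _  = refl
cubeVal-cong (l ∷ C) eq = cong₂ _∧_ (litVal-cong l (eq (here refl))) (cubeVal-cong C (eq ∘ there))

clauseVal-cong : ∀ {ρ σ} Cl → (∀ {l} → l ∈ Cl → ρ (var l) ≡ σ (var l)) →
  clauseVal ρ Cl ≡ clauseVal σ Cl
clauseVal-cong []       _  = refl
clauseVal-cong (l ∷ Cl) eq = cong₂ _∨_ (litVal-cong l (eq (here refl))) (clauseVal-cong Cl (eq ∘ there))

cnfVal-cong : ∀ {ρ σ} φ → (∀ {Cl l} → Cl ∈ φ → l ∈ Cl → ρ (var l) ≡ σ (var l)) →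
  cnfVal φ ρ ≡ cnfVal φ σ
cnfVal-cong []       _  = refl
cnfVal-cong (Cl ∷ φ) eq = cong₂ _∧_ (clauseVal-cong Cl (eq (here refl))) (cnfVal-cong φ (eq ∘ there))

quantOp-mono : ∀ q {a b a' b'} → (T a → T a') → (T b → T b') → T (quantOp q a b) → T (quantOp q a' b')
quantOp-mono ∀q f g = from T-∧ ∘ Prod.map f g ∘ to T-∧
quantOp-mono ∃q f g = from T-∨ ∘ Sum.map f g ∘ to T-∨

quantOp-idem : ∀ q a → quantOp q a a ≡ a
quantOp-idem ∀q true  = refl
quantOp-idem ∀q false = refl
quantOp-idem ∃q true  = refl
quantOp-idem ∃q false = refl

evalVars-++ : ∀ ps ps' F ρ → evalVars (ps ++ ps') F ρ ≡ evalVars ps (evalVars ps' F) ρ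
evalVars-++ []             ps' F ρ = refl
evalVars-++ ((q , x) ∷ ps) ps' F ρ =
  cong₂ (quantOp q) (evalVars-++ ps ps' F (update ρ x true)) (evalVars-++ ps ps' F (update ρ x false))

evalVars-mono-agree : ∀ ps {F G} ρ →
  (∀ σ → (∀ y → y ∉ boundVars ps → σ y ≡ ρ y) → T (F σ) → T (G σ)) →
  T (evalVars ps F ρ) → T (evalVars ps G ρ)
evalVars-mono-agree []             ρ F⇒G = F⇒G ρ (λ _ _ → refl)
evalVars-mono-agree ((q , x) ∷ ps) {F} {G} ρ F⇒G =
  quantOp-mono q (evalVars-mono-agree ps _ (branch true)) (evalVars-mono-agree ps _ (branch false))
  where
  branch : ∀ b σ → (∀ y → y ∉ boundVars ps → σ y ≡ update ρ x b y) → T (F σ) → T (G σ)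
  branch b σ agree = F⇒G σ λ y y∉ →
    trans (agree y (y∉ ∘ there)) (update-≢ ρ x b (y∉ ∘ here))

evalVars-mono : ∀ ps {F G} ρ → F ⇒ᴹ G → T (evalVars ps F ρ) → T (evalVars ps G ρ)
evalVars-mono ps ρ F⇒G = evalVars-mono-agree ps ρ (λ σ _ → F⇒G σ)

Consistent : Cube → Set
Consistent D = ∀ {l l'} → l ∈ D → l' ∈ D → var l ≡ var l' → pos l ≡ pos l'

¬Contradictory⇒Consistent : ¬ Contradictory D → Consistent D
¬Contradictory⇒Consistent {D} nc {lit x b} {lit .x c} m m' refl with b Bool.≟ c
... | yes b≡c = b≡c
... | no  b≢c = ⊥-elim (nc (lose m (subst (λ c′ → lit x c′ ∈ D) (¬-not (b≢c ∘ sym)) m')))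

polarity : Cube → ℕ → Bool
polarity []      x = true
polarity (l ∷ D) x = if var l ≡ᵇ x then pos l else polarity D x

polarity-pos : Consistent D → l ∈ D → pos l ≡ polarity D (var l)
polarity-pos {l₁ ∷ D} {l} cons m with var l₁ ≡ᵇ var l in e | m
... | true  | _         = cons m (here refl) (sym (≡ᵇ⇒≡ _ _ (from T-≡ e)))
... | false | here refl = ⊥-elim (subst T e (≡⇒≡ᵇ (var l) (var l) refl))
... | false | there m'  = polarity-pos (λ a b → cons (there a) (there b)) m'

HoldsOutside : Cube → List ℕ → Valuation → Set
HoldsOutside D xs ρ = ∀ {l} → l ∈ D → var l ∉ xs → T (litVal ρ l)

NoUniversalIn : List (Quant × ℕ) → Cube → Set
NoUniversalIn ps D = ∀ {y l} → (∀q , y) ∈ ps → l ∈ D → var l ≢ y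

holdsOutside-update : ∀ {xs} ρ b → (∀ {l} → l ∈ D → var l ≡ x → pos l ≡ b) →
  HoldsOutside D (x ∷ xs) ρ → HoldsOutside D xs (update ρ x b)
holdsOutside-update {x = x} ρ b agree sat {l} m l∉ with var l ≟ x
... | yes refl = subst (λ b → T (litVal (update ρ (var l) b) l)) (agree m refl) (litVal-update-pos ρ l)
... | no  l≢x  = subst T (sym (litVal-cong l (update-≢ ρ x b l≢x)))
                   (sat m λ { (here e) → l≢x e ; (there i) → l∉ i })

-- The existential player sets each of its variables to the polarity it has in D.
evalVars-cube : Consistent D → ∀ ps ρ → NoUniversalIn ps D → HoldsOutside D (boundVars ps) ρ →
  T (evalVars ps (cubeVal D) ρ)
evalVars-cube cons [] ρ _ sat = all⁻ _ (All.tabulate λ m → sat m λ ())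
evalVars-cube {D} cons ((∀q , x) ∷ ps) ρ noU sat = from T-∧ (branch true , branch false)
  where
  branch : ∀ b → T (evalVars ps (cubeVal D) (update ρ x b))
  branch b = evalVars-cube cons ps _ (noU ∘ there)
    (holdsOutside-update ρ b (λ m e → ⊥-elim (noU (here refl) m e)) sat)
evalVars-cube {D} cons ((∃q , x) ∷ ps) ρ noU sat =
  choose (polarity D x) (evalVars-cube cons ps _ (noU ∘ there)
    (holdsOutside-update ρ _ (λ { m refl → polarity-pos cons m }) sat))
  where
  choose : ∀ b → T (evalVars ps (cubeVal D) (update ρ x b)) →
    T (evalVars ps (cubeVal D) (update ρ x true) ∨ evalVars ps (cubeVal D) (update ρ x false))
  choose true  = from T-∨ ∘ inj₁
  choose false = from T-∨ ∘ inj₂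

-- If E holds at σ, the existential player makes D true as well; otherwise E stays
-- false throughout, since its variables are not bound in ps.
evalVars-cube-extend : ∀ M → Consistent D → ∀ ps σ →
  (∀ {l} → l ∈ E → var l ∉ boundVars ps) → NoUniversalIn ps D →
  (∀ {l} → l ∈ D → l ∈ E ⊎ var l ∈ boundVars ps) →
  T (evalVars ps (M ∨ᶜ E) σ) → T (evalVars ps (M ∨ᶜ D) σ)
evalVars-cube-extend {D} {E} M cons ps σ E-unbound noU D⊆E∪ps h with cubeVal E σ in Eσ
... | true  = evalVars-mono ps σ (λ _ → from T-∨ ∘ inj₂) (evalVars-cube cons ps σ noU sat)
  where
  sat : HoldsOutside D (boundVars ps) σ
  sat m l∉ = Sum.[ All.lookup (all⁺ _ E (from T-≡ Eσ)) , ⊥-elim ∘ l∉ ] (D⊆E∪ps m)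
... | false = evalVars-mono-agree ps σ keepM h
  where
  keepM : ∀ τ → (∀ y → y ∉ boundVars ps → τ y ≡ σ y) → T ((M ∨ᶜ E) τ) → T ((M ∨ᶜ D) τ)
  keepM τ agree h' with to T-∨ h'
  ... | inj₁ Mτ = from T-∨ (inj₁ Mτ)
  ... | inj₂ Eτ = ⊥-elim (subst T (trans (cubeVal-cong E (λ m → agree _ (E-unbound m))) Eσ) Eτ)

flatten-cons : ∀ q xs Q → flatten ((q , xs) ∷ Q) ≡ map (q ,_) xs ++ flatten Q
flatten-cons q []       Q = refl
flatten-cons q (x ∷ xs) Q = cong ((q , x) ∷_) (flatten-cons q xs Q)

flatten-++ : ∀ Q R → flatten (Q ++ R) ≡ flatten Q ++ flatten R
flatten-++ []             R = refl
flatten-++ ((q , xs) ∷ Q) R = begin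
  flatten ((q , xs) ∷ Q ++ R)               ≡⟨ flatten-cons q xs (Q ++ R) ⟩
  map (q ,_) xs ++ flatten (Q ++ R)         ≡⟨ cong (map (q ,_) xs ++_) (flatten-++ Q R) ⟩
  map (q ,_) xs ++ flatten Q ++ flatten R   ≡⟨ ++-assoc (map (q ,_) xs) (flatten Q) (flatten R) ⟨
  (map (q ,_) xs ++ flatten Q) ++ flatten R ≡⟨ cong (_++ flatten R) (flatten-cons q xs Q) ⟨
  flatten ((q , xs) ∷ Q) ++ flatten R       ∎
  where open ≡-Reasoning

boundVars-flatten : ∀ Q → boundVars (flatten Q) ≡ prefixVars Q
boundVars-flatten []                 = refl
boundVars-flatten ((q , [])     ∷ Q) = boundVars-flatten Q
boundVars-flatten ((q , x ∷ xs) ∷ Q) = cong (x ∷_) (boundVars-flatten ((q , xs) ∷ Q))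

∈-flatten⇒∈-prefixVars : ∀ Q → (q , x) ∈ flatten Q → x ∈ prefixVars Q
∈-flatten⇒∈-prefixVars Q m = subst (_ ∈_) (boundVars-flatten Q) (∈-map⁺ proj₂ m)

∈-flatten-cons⁻ : ∀ q' xs Q → (q , x) ∈ flatten ((q' , xs) ∷ Q) →
  (q ≡ q' × x ∈ xs) ⊎ (q , x) ∈ flatten Q
∈-flatten-cons⁻ q' xs Q m with ∈-++⁻ (map (q' ,_) xs) (subst (_ ∈_) (flatten-cons q' xs Q) m)
... | inj₂ m₂ = inj₂ m₂
... | inj₁ m₁ with ∈-map⁻ (q' ,_) m₁
...   | _ , y∈xs , refl = inj₁ (refl , y∈xs)

prefixVars-drop⊆ : ∀ n Q → x ∈ prefixVars (drop n Q) → x ∈ prefixVars Q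
prefixVars-drop⊆ zero    Q              m = m
prefixVars-drop⊆ (suc n) []             m = m
prefixVars-drop⊆ (suc n) ((q , xs) ∷ Q) m = ∈-++⁺ʳ xs (prefixVars-drop⊆ n Q m)

blockOfFrom⇒∈-flatten : ∀ Q i {k} → blockOfFrom i Q x ≡ just (k , q) → (q , x) ∈ flatten Q
blockOfFrom⇒∈-flatten {x} ((q' , xs) ∷ Q) i eq with memNat x xs in x∈?
blockOfFrom⇒∈-flatten {x} ((q' , xs) ∷ Q) i refl | true =
  subst (_ ∈_) (sym (flatten-cons q' xs Q))
    (∈-++⁺ˡ (∈-map⁺ (q' ,_) (memNat⇒∈ {xs = xs} (from T-≡ x∈?))))
... | false =
  subst (_ ∈_) (sym (flatten-cons q' xs Q)) (∈-++⁺ʳ (map (q' ,_) xs) (blockOfFrom⇒∈-flatten Q (suc i) eq))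

∈-flatten-drop⁻ : ∀ Q n i → Unique (prefixVars Q) → (q , x) ∈ flatten (drop n Q) →
  ∃[ k ] blockOfFrom i Q x ≡ just (k , q) × i + n ≤ k
∈-flatten-drop⁻ ((q' , xs) ∷ Q) zero i u m with ∈-flatten-cons⁻ q' xs Q m
... | inj₁ (refl , x∈xs) rewrite ∈⇒memNat x∈xs = i , refl , ≤-reflexive (+-identityʳ i)
... | inj₂ m′ rewrite ∉⇒memNat (Unique-++-disjoint xs u (∈-flatten⇒∈-prefixVars Q m′))
  with ∈-flatten-drop⁻ Q zero (suc i) (Unique-++⁻ʳ xs u) m′
...   | k , eq , le = k , eq , ≤-trans (n≤1+n _) le
∈-flatten-drop⁻ ((q' , xs) ∷ Q) (suc n) i u m
  rewrite ∉⇒memNat (Unique-++-disjoint xs u (prefixVars-drop⊆ n Q (∈-flatten⇒∈-prefixVars (drop n Q) m)))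
  with ∈-flatten-drop⁻ Q n (suc i) (Unique-++⁻ʳ xs u) m
... | k , eq , le = k , eq , subst (_≤ k) (sym (+-suc i n)) le

∈-flatten-drop⁺ : ∀ Q n i {k} → blockOfFrom i Q x ≡ just (k , q) → i + n ≤ k →
  (q , x) ∈ flatten (drop n Q)
∈-flatten-drop⁺ Q zero i eq _ = blockOfFrom⇒∈-flatten Q i eq
∈-flatten-drop⁺ {x} ((q' , xs) ∷ Q) (suc n) i {k} eq le with memNat x xs
∈-flatten-drop⁺ ((q' , xs) ∷ Q) (suc n) i {k} refl le | true =
  ⊥-elim (1+n≰n (≤-trans (s≤s (m≤m+n i n)) (subst (_≤ i) (+-suc i n) le)))
... | false = ∈-flatten-drop⁺ Q n (suc i) eq (subst (_≤ k) (+-suc i n) le)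

satisfiable-mono : ∀ Q {M N} → M ⇒ᴹ N → Satisfiable Q M → Satisfiable Q N
satisfiable-mono Q M⇒N = to T-≡ ∘ evalVars-mono (flatten Q) _ M⇒N ∘ from T-≡

satisfiable-split : ∀ Q n {F G} →
  evalVars (flatten (drop n Q)) F ⇒ᴹ evalVars (flatten (drop n Q)) G →
  Satisfiable Q F → Satisfiable Q G
satisfiable-split Q n {F} {G} step =
  to T-≡ ∘ subst T (sym (eval-split G)) ∘ evalVars-mono pre _ step ∘ subst T (eval-split F) ∘ from T-≡
  where
  pre post : List (Quant × ℕ)
  pre  = flatten (take n Q)
  post = flatten (drop n Q)
  flatten-split : flatten Q ≡ pre ++ post
  flatten-split = trans (cong flatten (sym (take++drop≡id n Q))) (flatten-++ (take n Q) (drop n Q))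
  eval-split : ∀ F → evalVars (flatten Q) F (λ _ → false) ≡ evalVars pre (evalVars post F) (λ _ → false)
  eval-split F = trans (cong (λ ps → evalVars ps F _) flatten-split) (evalVars-++ pre post F _)

quantEq⇒≡ : ∀ q q' → T (quantEq q q') → q ≡ q'
quantEq⇒≡ ∀q ∀q _ = refl
quantEq⇒≡ ∃q ∃q _ = refl

flatten-consBlock : ∀ q ys R → flatten (consBlock q ys R) ≡ map (q ,_) ys ++ flatten R
flatten-consBlock q []           R = refl
flatten-consBlock q ys@(_ ∷ _) [] = flatten-cons q ys []
flatten-consBlock q ys@(_ ∷ _) ((q' , zs) ∷ R) with quantEq q q' in e
... | false = flatten-cons q ys ((q' , zs) ∷ R)
... | true with quantEq⇒≡ q q' (from T-≡ e)
...   | refl = begin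
  flatten ((q , ys ++ zs) ∷ R)                  ≡⟨ flatten-cons q (ys ++ zs) R ⟩
  map (q ,_) (ys ++ zs) ++ flatten R            ≡⟨ cong (_++ flatten R) (map-++ (q ,_) ys zs) ⟩
  (map (q ,_) ys ++ map (q ,_) zs) ++ flatten R ≡⟨ ++-assoc (map (q ,_) ys) (map (q ,_) zs) (flatten R) ⟩
  map (q ,_) ys ++ map (q ,_) zs ++ flatten R   ≡⟨ cong (map (q ,_) ys ++_) (flatten-cons q zs R) ⟨
  map (q ,_) ys ++ flatten ((q , zs) ∷ R)       ∎
  where open ≡-Reasoning

flatten-removeVars : ∀ del Q → flatten (removeVars del Q) ≡ filterB (not ∘ del ∘ proj₂) (flatten Q)
flatten-removeVars del []             = refl
flatten-removeVars del ((q , xs) ∷ Q) = begin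
  flatten (consBlock q (filterB (not ∘ del) xs) (removeVars del Q))
    ≡⟨ flatten-consBlock q (filterB (not ∘ del) xs) (removeVars del Q) ⟩
  map (q ,_) (filterB (not ∘ del) xs) ++ flatten (removeVars del Q)
    ≡⟨ cong₂ _++_ (sym (filterB-map keep (q ,_) xs)) (flatten-removeVars del Q) ⟩
  filterB keep (map (q ,_) xs) ++ filterB keep (flatten Q)
    ≡⟨ filterB-++ keep (map (q ,_) xs) (flatten Q) ⟨
  filterB keep (map (q ,_) xs ++ flatten Q)
    ≡⟨ cong (filterB keep) (flatten-cons q xs Q) ⟨
  filterB keep (flatten ((q , xs) ∷ Q)) ∎
  where
  open ≡-Reasoning
  keep : Quant × ℕ → Bool
  keep = not ∘ del ∘ proj₂

AgreeOff : (ℕ → Bool) → Valuation → Valuation → Set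
AgreeOff del ρ σ = ∀ y → T (not (del y)) → ρ y ≡ σ y

IndependentOf : (ℕ → Bool) → Matrix → Set
IndependentOf del F = ∀ ρ σ → AgreeOff del ρ σ → F ρ ≡ F σ

evalVars-filter : ∀ del ps {F} → IndependentOf del F → ∀ ρ σ → AgreeOff del ρ σ →
  evalVars ps F ρ ≡ evalVars (filterB (not ∘ del ∘ proj₂) ps) F σ
evalVars-filter del []             ind ρ σ agree = ind ρ σ agree
evalVars-filter del ((q , x) ∷ ps) ind ρ σ agree with del x in x-del
... | true = trans
  (cong₂ (quantOp q) (evalVars-filter del ps ind _ σ (agree-update true))
                     (evalVars-filter del ps ind _ σ (agree-update false)))
  (quantOp-idem q _)
  where
  agree-update : ∀ b → AgreeOff del (update ρ x b) σ
  agree-update b y y-kept = trans (update-≢ ρ x b λ { refl → subst (T ∘ not) x-del y-kept }) (agree y y-kept)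
... | false = cong₂ (quantOp q)
  (evalVars-filter del ps ind _ _ (agree-update true)) (evalVars-filter del ps ind _ _ (agree-update false))
  where
  agree-update : ∀ b → AgreeOff del (update ρ x b) (update σ x b)
  agree-update b y y-kept with y ≡ᵇ x
  ... | true  = refl
  ... | false = agree y y-kept

removeVars-satisfiable : ∀ del Q {F} → IndependentOf del F → Satisfiable (removeVars del Q) F ⇔ Satisfiable Q F
removeVars-satisfiable del Q {F} ind = mk⇔ (trans (sym eval-eq)) (trans eval-eq)
  where
  eval-eq : evalVars (flatten (removeVars del Q)) F (λ _ → false) ≡ evalVars (flatten Q) F (λ _ → false)
  eval-eq = trans (cong (λ ps → evalVars ps F _) (flatten-removeVars del Q))
                  (sym (evalVars-filter del (flatten Q) ind _ _ (λ _ _ → refl)))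

inVdel-occurs : ∀ Q φ {Cl} → Cl ∈ φ → l ∈ Cl → T (not (inVdel Q φ (var l)))
inVdel-occurs {l} Q φ Cl∈φ l∈Cl =
  kept (memNat (var l) (prefixVars Q))
       (any⁺ _ (lose Cl∈φ (any⁺ _ (lose l∈Cl (≡⇒≡ᵇ (var l) (var l) refl)))))
  where
  kept : ∀ a {b} → T b → T (not (a ∧ not b))
  kept true  {true} _ = tt
  kept false {true} _ = tt

module _ (Q : Prefix) where

  rank : Lit → ℕ
  rank l with blockOf Q (var l)
  ... | just (i , ∀q) = suc i
  ... | _             = 0

  depth : Cube → ℕ
  depth = foldr (λ l n → rank l ⊔ n) 0

  rank≤depth : l ∈ D → rank l ≤ depth D
  rank≤depth {l} {_ ∷ D} (here refl) = m≤m⊔n (rank l) (depth D)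
  rank≤depth {_} {l ∷ D} (there m)   = ≤-trans (rank≤depth m) (m≤n⊔m (rank l) (depth D))

  depth-lub : ∀ D {k} → (∀ {l} → l ∈ D → rank l ≤ k) → depth D ≤ k
  depth-lub []      _     = z≤n
  depth-lub (l ∷ D) bound = ⊔-lub (bound (here refl)) (depth-lub D (bound ∘ there))

  universalsBefore : Cube → Lit → Bool
  universalsBefore D l = all (λ l' → not (isUnivB Q l') ∨ ltB Q l' l) D

  universalsBefore⁺ : ∀ {k q} → blockOf Q (var l) ≡ just (k , q) → depth D ≤ k → T (universalsBefore D l)
  universalsBefore⁺ {l} {D} {k} bl depth≤k =
    all⁻ _ (All.tabulate (λ {l'} m → precedes {l'} (≤-trans (rank≤depth {D = D} m) depth≤k)))
    where
    precedes : ∀ {l'} → rank l' ≤ k → T (not (isUnivB Q l') ∨ ltB Q l' l)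
    precedes {l'} r≤k with blockOf Q (var l')
    ... | just (j , ∀q) rewrite bl = <⇒<ᵇ r≤k
    ... | just (j , ∃q) = tt
    ... | nothing       = tt

  universalsBefore⁻ : ∀ {k q} → blockOf Q (var l) ≡ just (k , q) → T (universalsBefore D l) → depth D ≤ k
  universalsBefore⁻ {l} {D} {k} bl before =
    depth-lub D (λ {l'} m → precedes {l'} (All.lookup (all⁺ _ D before) m))
    where
    precedes : ∀ {l'} → T (not (isUnivB Q l') ∨ ltB Q l' l) → rank l' ≤ k
    precedes {l'} h with blockOf Q (var l')
    ... | just (j , ∀q) rewrite bl = <ᵇ⇒< j k h
    ... | just (j , ∃q) = z≤n
    ... | nothing       = z≤n

  rank-∀ : ∀ {k} → blockOf Q (var l) ≡ just (k , ∀q) → rank l ≡ suc k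
  rank-∀ {l} bl with blockOf Q (var l)
  rank-∀ refl | _ = refl

  universal<depth : ∀ {k} → l ∈ D → blockOf Q (var l) ≡ just (k , ∀q) → k < depth D
  universal<depth {l} {D} m bl = subst (_≤ depth D) (rank-∀ {l} bl) (rank≤depth m)

  isExistB-∃ : ∀ {k} → blockOf Q (var l) ≡ just (k , ∃q) → T (isExistB Q l)
  isExistB-∃ {l} bl with blockOf Q (var l)
  isExistB-∃ refl | _ = tt

  isExistB⇒∃ : T (isExistB Q l) → ∃[ k ] blockOf Q (var l) ≡ just (k , ∃q)
  isExistB⇒∃ {l} h with blockOf Q (var l)
  ... | just (k , ∃q) = k , refl

  module _ (uniq : Unique (prefixVars Q)) where

    -- The blocks after the last universal block of D.
    tailFrom : Cube → List (Quant × ℕ)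
    tailFrom D = flatten (drop (depth D) Q)

    ER-unbound : l ∈ ER Q D → var l ∉ boundVars (tailFrom D)
    ER-unbound {l} {D} m bound
      with ∈-filterB⁻ (λ l → not (isExistB Q l ∧ universalsBefore D l)) m | ∈-map⁻ proj₂ bound
    ... | l∈D , _ | (∀q , _) , ux∈ , refl with ∈-flatten-drop⁻ Q (depth D) 0 uniq ux∈
    ...   | k , bl , depth≤k = <⇒≱ (universal<depth {l} {D} l∈D bl) depth≤k
    ER-unbound {l} {D} m bound | _ , kept | (∃q , _) , ex∈ , refl
      with ∈-flatten-drop⁻ Q (depth D) 0 uniq ex∈
    ...   | k , bl , depth≤k = not-both kept (isExistB-∃ {l} bl) (universalsBefore⁺ {l} {D} bl depth≤k)
      where
      not-both : ∀ {a b} → T (not (a ∧ b)) → T a → T b → ⊥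
      not-both {true} {true} ()

    noUniversal-tailFrom : NoUniversalIn (tailFrom D) D
    noUniversal-tailFrom {D} {l = l} ux∈ l∈D refl with ∈-flatten-drop⁻ Q (depth D) 0 uniq ux∈
    ... | k , bl , depth≤k = <⇒≱ (universal<depth {l} {D} l∈D bl) depth≤k

    ER-cover : l ∈ D → l ∈ ER Q D ⊎ var l ∈ boundVars (tailFrom D)
    ER-cover {l} {D} l∈D with isExistB Q l ∧ universalsBefore D l in removed
    ... | false = inj₁ (∈-filterB⁺ (λ l → not (isExistB Q l ∧ universalsBefore D l)) l∈D
                                    (subst (T ∘ not) (sym removed) tt))
    ... | true with to T-∧ (from T-≡ removed)
    ...   | existential , before with isExistB⇒∃ {l} existential
    ...     | k , bl =
      inj₂ (∈-map⁺ proj₂ (∈-flatten-drop⁺ Q (depth D) 0 bl (universalsBefore⁻ {l} {D} bl before)))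

    satisfiable-∨ᶜ-ER : ∀ (keep : Lit → Bool) M → Consistent D →
      Satisfiable Q (M ∨ᶜ filterB keep (ER Q D)) → Satisfiable Q (M ∨ᶜ filterB keep D)
    satisfiable-∨ᶜ-ER {D} keep M cons = satisfiable-split Q (depth D) λ σ →
      evalVars-cube-extend {D = filterB keep D} {E = filterB keep (ER Q D)} M
        (λ a b → cons (∈-kept a) (∈-kept b)) (tailFrom D) σ
        (ER-unbound {D = D} ∘ ∈-kept)
        (λ ux∈ → noUniversal-tailFrom {D = D} ux∈ ∘ ∈-kept)
        (λ m → let l∈D , kept = ∈-filterB⁻ keep {D} m in
               Sum.map₁ (λ e → ∈-filterB⁺ keep e kept) (ER-cover l∈D))
      where
      ∈-kept : ∀ {C l} → l ∈ filterB keep C → l ∈ C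
      ∈-kept = proj₁ ∘ ∈-filterB⁻ keep

antecedent-from-resolvent : ∀ (keep : Lit → Bool) C R l₀ ρ → T (litVal ρ l₀) →
  (∀ {l} → l ∈ removeLit l₀ C → l ∈ R) →
  T (cubeVal (filterB keep R) ρ) → T (cubeVal (filterB keep C) ρ)
antecedent-from-resolvent keep C R l₀ ρ l₀-true ⊆R R-true = all⁻ _ (All.tabulate literal-true)
  where
  literal-true : ∀ {l} → l ∈ filterB keep C → T (litVal ρ l)
  literal-true m with ∈-filterB⁻ keep {C} m
  ... | l∈C , kept with removeLit-cover l₀ {C} l∈C
  ...   | inj₁ refl = l₀-true
  ...   | inj₂ l∈C⁻ = All.lookup (all⁺ _ _ R-true) (∈-filterB⁺ keep (⊆R l∈C⁻) kept)

resolvent⇒ER-antecedent : ∀ Q (keep : Lit → Bool) C₁ C₂ p ρ →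
  T (cubeVal (filterB keep (resolvent Q C₁ C₂ p)) ρ) →
  T (cubeVal (filterB keep (ER Q C₁)) ρ ∨ cubeVal (filterB keep (ER Q C₂)) ρ)
resolvent⇒ER-antecedent Q keep C₁ C₂ p ρ h with ρ p in ρp
... | true  = from T-∨ (inj₁ (antecedent-from-resolvent keep (ER Q C₁) (resolvent Q C₁ C₂ p) (lit p true) ρ
                               (subst T (sym ρp) tt) ∈-++⁺ˡ h))
... | false = from T-∨ (inj₂ (antecedent-from-resolvent keep (ER Q C₂) (resolvent Q C₁ C₂ p) (lit p false) ρ
                               (subst (T ∘ not) (sym ρp) tt) (∈-++⁺ʳ _) h))

derivable-consistent : ∀ {ψ} → CubeDerivable ψ C → Consistent C
derivable-consistent (modelGen A (nc , _))         = ¬Contradictory⇒Consistent nc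
derivable-consistent (cubeRes _ _ _ _ _ _ _ _ nc) = ¬Contradictory⇒Consistent nc
derivable-consistent (existRed d) a b =
  derivable-consistent d (proj₁ (∈-filterB⁻ _ a)) (proj₁ (∈-filterB⁻ _ b))

module _ {Q : Prefix} {φ φ' : CNF} (uniq : Unique (prefixVars Q))
         (φ'⊆φ : ∀ {Cl} → Cl ∈ φ' → Cl ∈ φ)
         {del : ℕ → Bool} (del-fresh : ∀ {Cl l} → Cl ∈ φ' → l ∈ Cl → T (not (del (var l)))) where

  Redundant : Cube → Set
  Redundant C = ∀ M → cnfVal φ' ⇒ᴹ M → Satisfiable Q (M ∨ᶜ reduceCube del C) → Satisfiable Q M

  model-redundant : ∀ {A} → IsModel (Q ∙ φ) A → Redundant A
  model-redundant {A} (_ , _ , covers) M φ'⇒M = satisfiable-mono Q λ ρ h →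
    Sum.[ id , φ'⇒M ρ ∘ satisfies-φ' ρ ] (to T-∨ h)
    where
    satisfies-φ' : ∀ ρ → T (cubeVal (reduceCube del A) ρ) → T (cnfVal φ' ρ)
    satisfies-φ' ρ A-true = all⁻ _ (All.tabulate clause-true)
      where
      clause-true : ∀ {Cl} → Cl ∈ φ' → T (clauseVal ρ Cl)
      clause-true Cl∈φ' with find (All.lookup covers (φ'⊆φ Cl∈φ'))
      ... | l , l∈Cl , l∈A = any⁺ _ (lose l∈Cl
        (All.lookup (all⁺ _ _ A-true) (∈-filterB⁺ (not ∘ del ∘ var) l∈A (del-fresh Cl∈φ' l∈Cl))))

  ER-redundant : Consistent D → Redundant D → Redundant (ER Q D)
  ER-redundant cons D-redundant M φ'⇒M =
    D-redundant M φ'⇒M ∘ satisfiable-∨ᶜ-ER Q uniq (not ∘ del ∘ var) M cons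

  resolvent-redundant : ∀ C₁ C₂ p → Redundant (ER Q C₁) → Redundant (ER Q C₂) →
    Redundant (resolvent Q C₁ C₂ p)
  resolvent-redundant C₁ C₂ p redundant₁ redundant₂ M φ'⇒M =
    redundant₁ M φ'⇒M ∘ redundant₂ (M ∨ᶜ reduceCube del (ER Q C₁)) (λ ρ → from T-∨ ∘ inj₁ ∘ φ'⇒M ρ) ∘
    satisfiable-mono Q λ ρ h → subst T (sym (∨-assoc (M ρ) _ _))
      (from T-∨ (Sum.map₂ (resolvent⇒ER-antecedent Q (not ∘ del ∘ var) C₁ C₂ p ρ) (to T-∨ h)))

  derivable-redundant : CubeDerivable (Q ∙ φ) C → Redundant C
  derivable-redundant (modelGen A model) = model-redundant model
  derivable-redundant (existRed d)       = ER-redundant (derivable-consistent d) (derivable-redundant d)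
  derivable-redundant (cubeRes {C₁} {C₂} p d₁ d₂ nc₁ nc₂ _ _ _ _) = resolvent-redundant C₁ C₂ p
    (ER-redundant (¬Contradictory⇒Consistent nc₁) (derivable-redundant d₁))
    (ER-redundant (¬Contradictory⇒Consistent nc₂) (derivable-redundant d₂))

proposition3 : (Q : Prefix) (φ : CNF) → IsClosedPCNF (Q ∙ φ) →
    (φdel : CNF) → All (_∈ φ) φdel →
    (C : Cube) → CubeDerivable (Q ∙ φ) C →
    let φ' = deleteClauses φ φdel
        del = inVdel Q φ'
        Q' = removeVars del Q
        C' = reduceCube del C
    in Satisfiable Q' (cnfVal φ') ⇔ Satisfiable Q' (λ ρ → cnfVal φ' ρ ∨ cubeVal C' ρ)
proposition3 Q φ closed φdel _ C derivable =
  mk⇔ (satisfiable-mono Q' λ _ → from T-∨ ∘ inj₁)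
      (from (removeVars-satisfiable del Q φ'-independent) ∘ C-redundant ∘
       to (removeVars-satisfiable del Q φ'∨C'-independent))
  where
  φ' : CNF
  φ' = deleteClauses φ φdel
  del : ℕ → Bool
  del = inVdel Q φ'
  Q' : Prefix
  Q' = removeVars del Q
  φ'-independent : IndependentOf del (cnfVal φ')
  φ'-independent ρ σ agree = cnfVal-cong φ' λ Cl∈φ' l∈Cl → agree _ (inVdel-occurs Q φ' Cl∈φ' l∈Cl)
  φ'∨C'-independent : IndependentOf del (cnfVal φ' ∨ᶜ reduceCube del C)
  φ'∨C'-independent ρ σ agree = cong₂ _∨_ (φ'-independent ρ σ agree)
    (cubeVal-cong (reduceCube del C) λ m → agree _ (proj₂ (∈-filterB⁻ (not ∘ del ∘ var) {C} m)))
  C-redundant : Satisfiable Q (cnfVal φ' ∨ᶜ reduceCube del C) → Satisfiable Q (cnfVal φ')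
  C-redundant = derivable-redundant (IsPCNF.disjointBlocks (IsClosedPCNF.isPCNF closed))
    (proj₁ ∘ ∈-filterB⁻ (λ Cl → not (memClause Cl φdel))) (inVdel-occurs Q φ')
    derivable (cnfVal φ') (λ _ → id)
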